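{- Let $\Gamma;\Delta\Longrightarrow C@w$ be a sequent derivable in the HyLL sequent calculus (described in the context) such that the sequent contains no occurrence of the hybrid connectives $\downarrow$, at, $\forall u$ or $\exists u$ (quantification over world variables), and every element of $\Gamma$ and of $\Delta$ has the form $A@w$ for the same world $w$. Then the sequent $\Gamma^{\circ};\Delta^{\circ}\Longrightarrow C$ is derivable in intuitionistic first-order linear logic (ILL), where $\Gamma^{\circ},\Delta^{\circ}$ are obtained from $\Gamma,\Delta$ by erasing the world label $@w$ from each judgement.
   Context: Fix a constraint domain, i.e. a monoid $\mathcal W=\langle W,\cdot,\iota\rangle$ whose elements are called worlds. World expressions $u,v,w$ are built from world variables and elements of $W$ using $\cdot$; terms are built from term variables and function symbols. HyLL propositions are $A,B::= a\,\vec t \mid A\otimes B\mid \mathbf 1\mid A\multimap B\mid A\,\&\,B\mid\top\mid A\oplus B\mid \mathbf 0\mid\, !A\mid \forall x.A\mid\exists x.A\mid (A\ \mathrm{at}\ w)\mid \downarrow u.A\mid\forall u.A\mid \exists u.A$, with $a$ a predicate symbol applied to terms, $x$ a term variable, $u$ a world variable ($\downarrow u$, $\forall u$, $\exists u$ bind $u$). $\alpha$ ranges over variables of either kind, $\tau$ over terms or world expressions accordingly, $[\tau/\alpha]A$ is capture-avoiding substitution, and propositions are identified up to $\alpha$-conversion. A judgement is $A@w$. Sequents have the form $\Gamma;\Delta\Longrightarrow C@w$ with $\Gamma$ a set (unrestricted context) and $\Delta$ a multiset (linear context) of judgements. The derivable sequents are generated by the rules (premises $\Rightarrow$ conclusion):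 init: $\Gamma;a\,\vec t@u\Longrightarrow a\,\vec t@u$; copy: from $\Gamma,A@u;\Delta,A@u\Longrightarrow C@w$ infer $\Gamma,A@u;\Delta\Longrightarrow C@w$; $\otimes$R: from $\Gamma;\Delta\Longrightarrow A@w$, $\Gamma;\Delta'\Longrightarrow B@w$ infer $\Gamma;\Delta,\Delta'\Longrightarrow A\otimes B@w$; $\otimes$L: from $\Gamma;\Delta,A@u,B@u\Longrightarrow C@w$ infer $\Gamma;\Delta,A\otimes B@u\Longrightarrow C@w$; $\mathbf1$R: $\Gamma;\cdot\Longrightarrow\mathbf1@w$; $\mathbf1$L: from $\Gamma;\Delta\Longrightarrow C@w$ infer $\Gamma;\Delta,\mathbf1@u\Longrightarrow C@w$; $\multimap$R: from $\Gamma;\Delta,A@w\Longrightarrow B@w$ infer $\Gamma;\Delta\Longrightarrow A\multimap B@w$; $\multimap$L: from $\Gamma;\Delta\Longrightarrow A@u$, $\Gamma;\Delta',B@u\Longrightarrow C@w$ infer $\Gamma;\Delta,\Delta',A\multimap B@u\Longrightarrow C@w$; $\top$R: $\Gamma;\Delta\Longrightarrow\top@w$; $\&$R: from $\Gamma;\Delta\Longrightarrow A@w$, $\Gamma;\Delta\Longrightarrow B@w$ infer $\Gamma;\Delta\Longrightarrow A\&B@w$; $\&$L$_i$: from $\Gamma;\Delta,A_i@u\Longrightarrow C@w$ infer $\Gamma;\Delta,A_1\&A_2@u\Longrightarrow C@w$; $\oplus$R$_i$: from $\Gamma;\Delta\Longrightarrow A_i@w$ infer $\Gamma;\Delta\Longrightarrow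 A_1\oplus A_2@w$; $\oplus$L: from $\Gamma;\Delta,A@u\Longrightarrow C@w$, $\Gamma;\Delta,B@u\Longrightarrow C@w$ infer $\Gamma;\Delta,A\oplus B@u\Longrightarrow C@w$; $\mathbf0$L: $\Gamma;\Delta,\mathbf0@u\Longrightarrow C@w$; $\forall$R: from $\Gamma;\Delta\Longrightarrow A@w$ infer $\Gamma;\Delta\Longrightarrow\forall\alpha.A@w$ ($\alpha$ fresh); $\forall$L: from $\Gamma;\Delta,[\tau/\alpha]A@u\Longrightarrow C@w$ infer $\Gamma;\Delta,\forall\alpha.A@u\Longrightarrow C@w$; $\exists$R: from $\Gamma;\Delta\Longrightarrow[\tau/\alpha]A@w$ infer $\Gamma;\Delta\Longrightarrow\exists\alpha.A@w$; $\exists$L: from $\Gamma;\Delta,A@u\Longrightarrow C@w$ infer $\Gamma;\Delta,\exists\alpha.A@u\Longrightarrow C@w$ ($\alpha$ fresh); !R: from $\Gamma;\cdot\Longrightarrow A@w$ infer $\Gamma;\cdot\Longrightarrow!A@w$; !L: from $\Gamma,A@u;\Delta\Longrightarrow C@w$ infer $\Gamma;\Delta,!A@u\Longrightarrow C@w$; at R: from $\Gamma;\Delta\Longrightarrow A@u$ infer $\Gamma;\Delta\Longrightarrow(A\ \mathrm{at}\ u)@v$; at L: from $\Gamma;\Delta,A@u\Longrightarrow C@w$ infer $\Gamma;\Delta,(A\ \mathrm{at}\ u)@v\Longrightarrow C@w$; $\downarrow$R: from $\Gamma;\Delta\Longrightarrow[w/u]A@w$ infer $\Gamma;\Delta\Longrightarrow\downarrow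 u.A@w$; $\downarrow$L: from $\Gamma;\Delta,[v/u]A@v\Longrightarrow C@w$ infer $\Gamma;\Delta,\downarrow u.A@v\Longrightarrow C@w$. ILL denotes the standard dyadic sequent calculus $\Gamma;\Delta\Longrightarrow C$ of intuitionistic first-order linear logic (the same rules without world labels and without the hybrid rules). -}

module Defs where

open import Level using (Level)
open import Data.Nat using (ℕ; zero; suc)
open import Data.List using (List; []; _∷_; _++_; map)
open import Data.List.Membership.Propositional using (_∈_)
open import Data.List.Relation.Binary.Permutation.Propositional using (_↭_)
open import Function using (_∘_)

-- First-order terms (de Bruijn indices for term variables).
-- Function symbols are named by natural numbers, applied to a list of
-- argument terms.

data Tm : Set where
  var : ℕ → Tm
  fn  : ℕ → List Tm → Tm

TSub : Set
TSub = ℕ → Tm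

mutual
  subTm : TSub → Tm → Tm
  subTm σ (var x)   = σ x
  subTm σ (fn f ts) = fn f (subTms σ ts)

  subTms : TSub → List Tm → List Tm
  subTms σ []       = []
  subTms σ (t ∷ ts) = subTm σ t ∷ subTms σ ts

liftT : TSub → TSub
liftT σ zero    = var zero
liftT σ (suc x) = subTm (var ∘ suc) (σ x)

singleT : Tm → TSub
singleT τ zero    = τ
singleT τ (suc x) = var x

shiftT : TSub
shiftT = var ∘ suc

-- World expressions over a carrier W (the worlds of the monoid):
-- world variables (de Bruijn), elements of W, and the product.

data Wd {c : Level} (W : Set c) : Set c where
  wvar : ℕ → Wd W
  wel  : W → Wd W
  _·_  : Wd W → Wd W → Wd W

module _ {c : Level} {W : Set c} where

  WSub : Set c
  WSub = ℕ → Wd W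

  subWd : WSub → Wd W → Wd W
  subWd ρ (wvar x) = ρ x
  subWd ρ (wel a)  = wel a
  subWd ρ (u · v)  = subWd ρ u · subWd ρ v

  liftW : WSub → WSub
  liftW ρ zero    = wvar zero
  liftW ρ (suc x) = subWd (wvar ∘ suc) (ρ x)

  singleW : Wd W → WSub
  singleW u zero    = u
  singleW u (suc x) = wvar x

  shiftW : WSub
  shiftW = wvar ∘ suc

-- HyLL propositions.  ∀t/∃t bind term variable 0; ↓, ∀w, ∃w bind
-- world variable 0 (term and world variables are separate index spaces).

infixr 10 _⊸_
infixr 11 _⊕_
infixr 12 _&_
infixr 13 _⊗_
infix  14 _at_

data Prop {c : Level} (W : Set c) : Set c where
  atom : ℕ → List Tm → Prop W
  _⊗_  : Prop W → Prop W → Prop W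
  𝟏    : Prop W
  _⊸_  : Prop W → Prop W → Prop W
  _&_  : Prop W → Prop W → Prop W
  ⊤ₚ   : Prop W
  _⊕_  : Prop W → Prop W → Prop W
  𝟎    : Prop W
  !_   : Prop W → Prop W
  ∀t   : Prop W → Prop W
  ∃t   : Prop W → Prop W
  _at_ : Prop W → Wd W → Prop W
  ↓_   : Prop W → Prop W
  ∀w   : Prop W → Prop W
  ∃w   : Prop W → Prop W

module _ {c : Level} {W : Set c} where

  subP : TSub → Prop W → Prop W
  subP σ (atom a ts) = atom a (subTms σ ts)
  subP σ (A ⊗ B)     = subP σ A ⊗ subP σ B
  subP σ 𝟏           = 𝟏
  subP σ (A ⊸ B)     = subP σ A ⊸ subP σ B
  subP σ (A & B)     = subP σ A & subP σ B
  subP σ ⊤ₚ          = ⊤ₚ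
  subP σ (A ⊕ B)     = subP σ A ⊕ subP σ B
  subP σ 𝟎           = 𝟎
  subP σ (! A)       = ! subP σ A
  subP σ (∀t A)      = ∀t (subP (liftT σ) A)
  subP σ (∃t A)      = ∃t (subP (liftT σ) A)
  subP σ (A at u)    = subP σ A at u
  subP σ (↓ A)       = ↓ subP σ A
  subP σ (∀w A)      = ∀w (subP σ A)
  subP σ (∃w A)      = ∃w (subP σ A)

  wsubP : WSub → Prop W → Prop W
  wsubP ρ (atom a ts) = atom a ts
  wsubP ρ (A ⊗ B)     = wsubP ρ A ⊗ wsubP ρ B
  wsubP ρ 𝟏           = 𝟏
  wsubP ρ (A ⊸ B)     = wsubP ρ A ⊸ wsubP ρ B
  wsubP ρ (A & B)     = wsubP ρ A & wsubP ρ B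
  wsubP ρ ⊤ₚ          = ⊤ₚ
  wsubP ρ (A ⊕ B)     = wsubP ρ A ⊕ wsubP ρ B
  wsubP ρ 𝟎           = 𝟎
  wsubP ρ (! A)       = ! wsubP ρ A
  wsubP ρ (∀t A)      = ∀t (wsubP ρ A)
  wsubP ρ (∃t A)      = ∃t (wsubP ρ A)
  wsubP ρ (A at u)    = wsubP ρ A at subWd ρ u
  wsubP ρ (↓ A)       = ↓ wsubP (liftW ρ) A
  wsubP ρ (∀w A)      = ∀w (wsubP (liftW ρ) A)
  wsubP ρ (∃w A)      = ∃w (wsubP (liftW ρ) A)

-- Judgements  A ＠ w   (＠ stands for @, which is reserved in Agda)

infix 6 _＠_

data Jdg {c : Level} (W : Set c) : Set c where
  _＠_ : Prop W → Wd W → Jdg W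

module _ {c : Level} {W : Set c} where

  tshiftJ : Jdg W → Jdg W
  tshiftJ (A ＠ u) = subP shiftT A ＠ u

  wshiftJ : Jdg W → Jdg W
  wshiftJ (A ＠ u) = wsubP shiftW A ＠ subWd shiftW u

-- HyLL sequent calculus  Γ ⨾ Δ ⟹ C ＠ w.
-- Γ : list read as a set (only accessed by membership / extension);
-- Δ : list read as a multiset (every rule is stated up to permutation _↭_).

infix 2 _⨾_⟹_

data _⨾_⟹_ {c : Level} {W : Set c} : List (Jdg W) → List (Jdg W) → Jdg W → Set c where
  init : ∀ {Γ a ts u} → Γ ⨾ (atom a ts ＠ u ∷ []) ⟹ atom a ts ＠ u
  copy : ∀ {Γ Δ A u C} → (A ＠ u) ∈ Γ → Γ ⨾ (A ＠ u ∷ Δ) ⟹ C → Γ ⨾ Δ ⟹ C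
  ⊗R : ∀ {Γ Δ Δ₁ Δ₂ A B w} → Δ ↭ Δ₁ ++ Δ₂ →
       Γ ⨾ Δ₁ ⟹ A ＠ w → Γ ⨾ Δ₂ ⟹ B ＠ w → Γ ⨾ Δ ⟹ A ⊗ B ＠ w
  ⊗L : ∀ {Γ Δ Δ' A B u C} → Δ ↭ (A ⊗ B ＠ u) ∷ Δ' →
       Γ ⨾ (A ＠ u ∷ B ＠ u ∷ Δ') ⟹ C → Γ ⨾ Δ ⟹ C
  𝟏R : ∀ {Γ w} → Γ ⨾ [] ⟹ 𝟏 ＠ w
  𝟏L : ∀ {Γ Δ Δ' u C} → Δ ↭ (𝟏 ＠ u) ∷ Δ' → Γ ⨾ Δ' ⟹ C → Γ ⨾ Δ ⟹ C
  ⊸R : ∀ {Γ Δ A B w} → Γ ⨾ (A ＠ w ∷ Δ) ⟹ B ＠ w → Γ ⨾ Δ ⟹ A ⊸ B ＠ w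
  ⊸L : ∀ {Γ Δ Δ₁ Δ₂ A B u C} → Δ ↭ (A ⊸ B ＠ u) ∷ (Δ₁ ++ Δ₂) →
       Γ ⨾ Δ₁ ⟹ A ＠ u → Γ ⨾ (B ＠ u ∷ Δ₂) ⟹ C → Γ ⨾ Δ ⟹ C
  ⊤R : ∀ {Γ Δ w} → Γ ⨾ Δ ⟹ ⊤ₚ ＠ w
  &R : ∀ {Γ Δ A B w} → Γ ⨾ Δ ⟹ A ＠ w → Γ ⨾ Δ ⟹ B ＠ w → Γ ⨾ Δ ⟹ A & B ＠ w
  &L₁ : ∀ {Γ Δ Δ' A B u C} → Δ ↭ (A & B ＠ u) ∷ Δ' → Γ ⨾ (A ＠ u ∷ Δ') ⟹ C → Γ ⨾ Δ ⟹ C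
  &L₂ : ∀ {Γ Δ Δ' A B u C} → Δ ↭ (A & B ＠ u) ∷ Δ' → Γ ⨾ (B ＠ u ∷ Δ') ⟹ C → Γ ⨾ Δ ⟹ C
  ⊕R₁ : ∀ {Γ Δ A B w} → Γ ⨾ Δ ⟹ A ＠ w → Γ ⨾ Δ ⟹ A ⊕ B ＠ w
  ⊕R₂ : ∀ {Γ Δ A B w} → Γ ⨾ Δ ⟹ B ＠ w → Γ ⨾ Δ ⟹ A ⊕ B ＠ w
  ⊕L : ∀ {Γ Δ Δ' A B u C} → Δ ↭ (A ⊕ B ＠ u) ∷ Δ' →
       Γ ⨾ (A ＠ u ∷ Δ') ⟹ C → Γ ⨾ (B ＠ u ∷ Δ') ⟹ C → Γ ⨾ Δ ⟹ C
  𝟎L : ∀ {Γ Δ Δ' u C} → Δ ↭ (𝟎 ＠ u) ∷ Δ' → Γ ⨾ Δ ⟹ C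
  -- term quantifiers (fresh eigenvariable = de Bruijn shift of the rest)
  ∀tR : ∀ {Γ Δ A w} → map tshiftJ Γ ⨾ map tshiftJ Δ ⟹ A ＠ w → Γ ⨾ Δ ⟹ ∀t A ＠ w
  ∀tL : ∀ {Γ Δ Δ' A u C} (τ : Tm) → Δ ↭ (∀t A ＠ u) ∷ Δ' →
        Γ ⨾ (subP (singleT τ) A ＠ u ∷ Δ') ⟹ C → Γ ⨾ Δ ⟹ C
  ∃tR : ∀ {Γ Δ A w} (τ : Tm) → Γ ⨾ Δ ⟹ subP (singleT τ) A ＠ w → Γ ⨾ Δ ⟹ ∃t A ＠ w
  ∃tL : ∀ {Γ Δ Δ' A u C} → Δ ↭ (∃t A ＠ u) ∷ Δ' →
        map tshiftJ Γ ⨾ (A ＠ u ∷ map tshiftJ Δ') ⟹ tshiftJ C → Γ ⨾ Δ ⟹ C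
  ∀wR : ∀ {Γ Δ A w} → map wshiftJ Γ ⨾ map wshiftJ Δ ⟹ A ＠ subWd shiftW w →
        Γ ⨾ Δ ⟹ ∀w A ＠ w
  ∀wL : ∀ {Γ Δ Δ' A u C} (τ : Wd W) → Δ ↭ (∀w A ＠ u) ∷ Δ' →
        Γ ⨾ (wsubP (singleW τ) A ＠ u ∷ Δ') ⟹ C → Γ ⨾ Δ ⟹ C
  ∃wR : ∀ {Γ Δ A w} (τ : Wd W) → Γ ⨾ Δ ⟹ wsubP (singleW τ) A ＠ w → Γ ⨾ Δ ⟹ ∃w A ＠ w
  ∃wL : ∀ {Γ Δ Δ' A u C} → Δ ↭ (∃w A ＠ u) ∷ Δ' →
        map wshiftJ Γ ⨾ (A ＠ subWd shiftW u ∷ map wshiftJ Δ') ⟹ wshiftJ C → Γ ⨾ Δ ⟹ C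
  !R : ∀ {Γ A w} → Γ ⨾ [] ⟹ A ＠ w → Γ ⨾ [] ⟹ ! A ＠ w
  !L : ∀ {Γ Δ Δ' A u C} → Δ ↭ (! A ＠ u) ∷ Δ' → (A ＠ u ∷ Γ) ⨾ Δ' ⟹ C → Γ ⨾ Δ ⟹ C
  atR : ∀ {Γ Δ A u v} → Γ ⨾ Δ ⟹ A ＠ u → Γ ⨾ Δ ⟹ (A at u) ＠ v
  atL : ∀ {Γ Δ Δ' A u v C} → Δ ↭ ((A at u) ＠ v) ∷ Δ' → Γ ⨾ (A ＠ u ∷ Δ') ⟹ C → Γ ⨾ Δ ⟹ C
  ↓R : ∀ {Γ Δ A w} → Γ ⨾ Δ ⟹ wsubP (singleW w) A ＠ w → Γ ⨾ Δ ⟹ (↓ A) ＠ w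
  ↓L : ∀ {Γ Δ Δ' A v C} → Δ ↭ ((↓ A) ＠ v) ∷ Δ' →
       Γ ⨾ (wsubP (singleW v) A ＠ v ∷ Δ') ⟹ C → Γ ⨾ Δ ⟹ C

module ILL where

  infixr 10 _⊸_
  infixr 11 _⊕_
  infixr 12 _&_
  infixr 13 _⊗_

  data IProp : Set where
    atom : ℕ → List Tm → IProp
    _⊗_  : IProp → IProp → IProp
    𝟏    : IProp
    _⊸_  : IProp → IProp → IProp
    _&_  : IProp → IProp → IProp
    ⊤ₚ   : IProp
    _⊕_  : IProp → IProp → IProp
    𝟎    : IProp
    !_   : IProp → IProp
    ∀t   : IProp → IProp
    ∃t   : IProp → IProp

  subI : TSub → IProp → IProp
  subI σ (atom a ts) = atom a (subTms σ ts)
  subI σ (A ⊗ B)     = subI σ A ⊗ subI σ B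
  subI σ 𝟏           = 𝟏
  subI σ (A ⊸ B)     = subI σ A ⊸ subI σ B
  subI σ (A & B)     = subI σ A & subI σ B
  subI σ ⊤ₚ          = ⊤ₚ
  subI σ (A ⊕ B)     = subI σ A ⊕ subI σ B
  subI σ 𝟎           = 𝟎
  subI σ (! A)       = ! subI σ A
  subI σ (∀t A)      = ∀t (subI (liftT σ) A)
  subI σ (∃t A)      = ∃t (subI (liftT σ) A)

  tshiftI : IProp → IProp
  tshiftI = subI shiftT

  infix 2 _⨾_⟹ᴵ_

  data _⨾_⟹ᴵ_ : List IProp → List IProp → IProp → Set where
    init : ∀ {Γ a ts} → Γ ⨾ (atom a ts ∷ []) ⟹ᴵ atom a ts
    copy : ∀ {Γ Δ A C} → A ∈ Γ → Γ ⨾ (A ∷ Δ) ⟹ᴵ C → Γ ⨾ Δ ⟹ᴵ C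
    ⊗R : ∀ {Γ Δ Δ₁ Δ₂ A B} → Δ ↭ Δ₁ ++ Δ₂ →
         Γ ⨾ Δ₁ ⟹ᴵ A → Γ ⨾ Δ₂ ⟹ᴵ B → Γ ⨾ Δ ⟹ᴵ A ⊗ B
    ⊗L : ∀ {Γ Δ Δ' A B C} → Δ ↭ (A ⊗ B) ∷ Δ' →
         Γ ⨾ (A ∷ B ∷ Δ') ⟹ᴵ C → Γ ⨾ Δ ⟹ᴵ C
    𝟏R : ∀ {Γ} → Γ ⨾ [] ⟹ᴵ 𝟏
    𝟏L : ∀ {Γ Δ Δ' C} → Δ ↭ 𝟏 ∷ Δ' → Γ ⨾ Δ' ⟹ᴵ C → Γ ⨾ Δ ⟹ᴵ C
    ⊸R : ∀ {Γ Δ A B} → Γ ⨾ (A ∷ Δ) ⟹ᴵ B → Γ ⨾ Δ ⟹ᴵ A ⊸ B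
    ⊸L : ∀ {Γ Δ Δ₁ Δ₂ A B C} → Δ ↭ (A ⊸ B) ∷ (Δ₁ ++ Δ₂) →
         Γ ⨾ Δ₁ ⟹ᴵ A → Γ ⨾ (B ∷ Δ₂) ⟹ᴵ C → Γ ⨾ Δ ⟹ᴵ C
    ⊤R : ∀ {Γ Δ} → Γ ⨾ Δ ⟹ᴵ ⊤ₚ
    &R : ∀ {Γ Δ A B} → Γ ⨾ Δ ⟹ᴵ A → Γ ⨾ Δ ⟹ᴵ B → Γ ⨾ Δ ⟹ᴵ A & B
    &L₁ : ∀ {Γ Δ Δ' A B C} → Δ ↭ (A & B) ∷ Δ' → Γ ⨾ (A ∷ Δ') ⟹ᴵ C → Γ ⨾ Δ ⟹ᴵ C
    &L₂ : ∀ {Γ Δ Δ' A B C} → Δ ↭ (A & B) ∷ Δ' → Γ ⨾ (B ∷ Δ') ⟹ᴵ C → Γ ⨾ Δ ⟹ᴵ C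
    ⊕R₁ : ∀ {Γ Δ A B} → Γ ⨾ Δ ⟹ᴵ A → Γ ⨾ Δ ⟹ᴵ A ⊕ B
    ⊕R₂ : ∀ {Γ Δ A B} → Γ ⨾ Δ ⟹ᴵ B → Γ ⨾ Δ ⟹ᴵ A ⊕ B
    ⊕L : ∀ {Γ Δ Δ' A B C} → Δ ↭ (A ⊕ B) ∷ Δ' →
         Γ ⨾ (A ∷ Δ') ⟹ᴵ C → Γ ⨾ (B ∷ Δ') ⟹ᴵ C → Γ ⨾ Δ ⟹ᴵ C
    𝟎L : ∀ {Γ Δ Δ' C} → Δ ↭ 𝟎 ∷ Δ' → Γ ⨾ Δ ⟹ᴵ C
    ∀tR : ∀ {Γ Δ A} → map tshiftI Γ ⨾ map tshiftI Δ ⟹ᴵ A → Γ ⨾ Δ ⟹ᴵ ∀t A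
    ∀tL : ∀ {Γ Δ Δ' A C} (τ : Tm) → Δ ↭ ∀t A ∷ Δ' →
          Γ ⨾ (subI (singleT τ) A ∷ Δ') ⟹ᴵ C → Γ ⨾ Δ ⟹ᴵ C
    ∃tR : ∀ {Γ Δ A} (τ : Tm) → Γ ⨾ Δ ⟹ᴵ subI (singleT τ) A → Γ ⨾ Δ ⟹ᴵ ∃t A
    ∃tL : ∀ {Γ Δ Δ' A C} → Δ ↭ ∃t A ∷ Δ' →
          map tshiftI Γ ⨾ (A ∷ map tshiftI Δ') ⟹ᴵ tshiftI C → Γ ⨾ Δ ⟹ᴵ C
    !R : ∀ {Γ A} → Γ ⨾ [] ⟹ᴵ A → Γ ⨾ [] ⟹ᴵ ! A
    !L : ∀ {Γ Δ Δ' A C} → Δ ↭ (! A) ∷ Δ' → (A ∷ Γ) ⨾ Δ' ⟹ᴵ C → Γ ⨾ Δ ⟹ᴵ C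

open ILL public using (IProp; _⨾_⟹ᴵ_)

-- ILL propositions are exactly the HyLL propositions with no occurrence of
-- ↓, at, ∀w, ∃w.  `embed` is this inclusion; "erasing the label @w" of a
-- hybrid-free judgement A@w gives the ILL proposition A.

embed : {c : Level} {W : Set c} → IProp → Prop W
embed (ILL.atom a ts) = atom a ts
embed (A ILL.⊗ B)     = embed A ⊗ embed B
embed ILL.𝟏           = 𝟏
embed (A ILL.⊸ B)     = embed A ⊸ embed B
embed (A ILL.& B)     = embed A & embed B
embed ILL.⊤ₚ          = ⊤ₚ
embed (A ILL.⊕ B)     = embed A ⊕ embed B
embed ILL.𝟎           = 𝟎
embed (ILL.! A)       = ! embed A
embed (ILL.∀t A)      = ∀t (embed A)
embed (ILL.∃t A)      = ∃t (embed A)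

_＠ₗ_ : {c : Level} {W : Set c} → List IProp → Wd W → List (Jdg W)
Γ ＠ₗ w = map (λ A → embed A ＠ w) Γ

-- Proof idea: worlds carry no logical content for the linear connectives, so
-- "forgetting the worlds" interprets HyLL in ILL.  The erasure |_| deletes
-- every hybrid connective ( |A at u| = |↓A| = |∀u.A| = |∃u.A| = |A| ) and every
-- world label ( |A@u| = |A| ).  We show, by induction on HyLL derivations, that
-- Γ;Δ ⟹ C@w implies |Γ|;|Δ| ⟹ |C| in ILL: every linear rule maps to its ILL
-- counterpart, hybrid right rules disappear, and hybrid left rules become a
-- mere reordering of the linear context.
module Submission where

open import Defs
open import Level using (Level)
open import Data.List using (List; []; _∷_; _++_; map)
open import Data.List.Properties using (map-++)
open import Data.List.Membership.Propositional.Properties using (∈-map⁺)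
open import Data.List.Relation.Binary.Permutation.Propositional
  using (_↭_; prep; ↭-sym; ↭-trans; ↭-reflexive)
open import Data.List.Relation.Binary.Permutation.Propositional.Properties
  using (map⁺; ↭-empty-inv; ↭-singleton-inv)
open import Algebra.Bundles using (Monoid)
open import Relation.Binary.PropositionalEquality using (_≡_; refl; trans; cong; cong₂)
open ILL using (subI; tshiftI)

exchange : ∀ {Γ Δ Δ' C} → Δ ↭ Δ' → Γ ⨾ Δ ⟹ᴵ C → Γ ⨾ Δ' ⟹ᴵ C
exchange q ILL.init with refl ← ↭-singleton-inv (↭-sym q) = ILL.init
exchange q ILL.𝟏R   with refl ← ↭-empty-inv (↭-sym q)     = ILL.𝟏R
exchange q (ILL.!R d) with refl ← ↭-empty-inv (↭-sym q)   = ILL.!R d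
exchange q (ILL.copy m d)   = ILL.copy m (exchange (prep _ q) d)
exchange q (ILL.⊗R p d e)   = ILL.⊗R (↭-trans (↭-sym q) p) d e
exchange q (ILL.⊗L p d)     = ILL.⊗L (↭-trans (↭-sym q) p) d
exchange q (ILL.𝟏L p d)     = ILL.𝟏L (↭-trans (↭-sym q) p) d
exchange q (ILL.⊸R d)       = ILL.⊸R (exchange (prep _ q) d)
exchange q (ILL.⊸L p d e)   = ILL.⊸L (↭-trans (↭-sym q) p) d e
exchange q ILL.⊤R           = ILL.⊤R
exchange q (ILL.&R d e)     = ILL.&R (exchange q d) (exchange q e)
exchange q (ILL.&L₁ p d)    = ILL.&L₁ (↭-trans (↭-sym q) p) d
exchange q (ILL.&L₂ p d)    = ILL.&L₂ (↭-trans (↭-sym q) p) d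
exchange q (ILL.⊕R₁ d)      = ILL.⊕R₁ (exchange q d)
exchange q (ILL.⊕R₂ d)      = ILL.⊕R₂ (exchange q d)
exchange q (ILL.⊕L p d e)   = ILL.⊕L (↭-trans (↭-sym q) p) d e
exchange q (ILL.𝟎L p)       = ILL.𝟎L (↭-trans (↭-sym q) p)
exchange q (ILL.∀tR d)      = ILL.∀tR (exchange (map⁺ tshiftI q) d)
exchange q (ILL.∀tL τ p d)  = ILL.∀tL τ (↭-trans (↭-sym q) p) d
exchange q (ILL.∃tR τ d)    = ILL.∃tR τ (exchange q d)
exchange q (ILL.∃tL p d)    = ILL.∃tL (↭-trans (↭-sym q) p) d
exchange q (ILL.!L p d)     = ILL.!L (↭-trans (↭-sym q) p) d

cast : ∀ {Γ Γ' Δ Δ' C C'} → Γ ≡ Γ' → Δ ≡ Δ' → C ≡ C' →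
       Γ ⨾ Δ ⟹ᴵ C → Γ' ⨾ Δ' ⟹ᴵ C'
cast refl refl refl d = d

module _ {c : Level} {W : Set c} where

  erase : Prop W → IProp
  erase (atom a ts) = ILL.atom a ts
  erase (A ⊗ B)     = erase A ILL.⊗ erase B
  erase 𝟏           = ILL.𝟏
  erase (A ⊸ B)     = erase A ILL.⊸ erase B
  erase (A & B)     = erase A ILL.& erase B
  erase ⊤ₚ          = ILL.⊤ₚ
  erase (A ⊕ B)     = erase A ILL.⊕ erase B
  erase 𝟎           = ILL.𝟎
  erase (! A)       = ILL.! erase A
  erase (∀t A)      = ILL.∀t (erase A)
  erase (∃t A)      = ILL.∃t (erase A)
  erase (A at u)    = erase A
  erase (↓ A)       = erase A
  erase (∀w A)      = erase A
  erase (∃w A)      = erase A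

  eraseJ : Jdg W → IProp
  eraseJ (A ＠ u) = erase A

  eraseCtx : List (Jdg W) → List IProp
  eraseCtx = map eraseJ

  erase-subP : ∀ σ A → erase (subP σ A) ≡ subI σ (erase A)
  erase-subP σ (atom a ts) = refl
  erase-subP σ (A ⊗ B)     = cong₂ ILL._⊗_ (erase-subP σ A) (erase-subP σ B)
  erase-subP σ 𝟏           = refl
  erase-subP σ (A ⊸ B)     = cong₂ ILL._⊸_ (erase-subP σ A) (erase-subP σ B)
  erase-subP σ (A & B)     = cong₂ ILL._&_ (erase-subP σ A) (erase-subP σ B)
  erase-subP σ ⊤ₚ          = refl
  erase-subP σ (A ⊕ B)     = cong₂ ILL._⊕_ (erase-subP σ A) (erase-subP σ B)
  erase-subP σ 𝟎           = refl
  erase-subP σ (! A)       = cong ILL.!_ (erase-subP σ A)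
  erase-subP σ (∀t A)      = cong ILL.∀t (erase-subP (liftT σ) A)
  erase-subP σ (∃t A)      = cong ILL.∃t (erase-subP (liftT σ) A)
  erase-subP σ (A at u)    = erase-subP σ A
  erase-subP σ (↓ A)       = erase-subP σ A
  erase-subP σ (∀w A)      = erase-subP σ A
  erase-subP σ (∃w A)      = erase-subP σ A

  erase-wsubP : ∀ ρ A → erase (wsubP ρ A) ≡ erase A
  erase-wsubP ρ (atom a ts) = refl
  erase-wsubP ρ (A ⊗ B)     = cong₂ ILL._⊗_ (erase-wsubP ρ A) (erase-wsubP ρ B)
  erase-wsubP ρ 𝟏           = refl
  erase-wsubP ρ (A ⊸ B)     = cong₂ ILL._⊸_ (erase-wsubP ρ A) (erase-wsubP ρ B)
  erase-wsubP ρ (A & B)     = cong₂ ILL._&_ (erase-wsubP ρ A) (erase-wsubP ρ B)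
  erase-wsubP ρ ⊤ₚ          = refl
  erase-wsubP ρ (A ⊕ B)     = cong₂ ILL._⊕_ (erase-wsubP ρ A) (erase-wsubP ρ B)
  erase-wsubP ρ 𝟎           = refl
  erase-wsubP ρ (! A)       = cong ILL.!_ (erase-wsubP ρ A)
  erase-wsubP ρ (∀t A)      = cong ILL.∀t (erase-wsubP ρ A)
  erase-wsubP ρ (∃t A)      = cong ILL.∃t (erase-wsubP ρ A)
  erase-wsubP ρ (A at u)    = erase-wsubP ρ A
  erase-wsubP ρ (↓ A)       = erase-wsubP (liftW ρ) A
  erase-wsubP ρ (∀w A)      = erase-wsubP (liftW ρ) A
  erase-wsubP ρ (∃w A)      = erase-wsubP (liftW ρ) A

  eraseJ-tshift : ∀ J → eraseJ (tshiftJ J) ≡ tshiftI (eraseJ J)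
  eraseJ-tshift (A ＠ u) = erase-subP shiftT A

  eraseJ-wshift : ∀ J → eraseJ (wshiftJ J) ≡ eraseJ J
  eraseJ-wshift (A ＠ u) = erase-wsubP shiftW A

  eraseCtx-tshift : ∀ Γ → eraseCtx (map tshiftJ Γ) ≡ map tshiftI (eraseCtx Γ)
  eraseCtx-tshift []      = refl
  eraseCtx-tshift (J ∷ Γ) = cong₂ _∷_ (eraseJ-tshift J) (eraseCtx-tshift Γ)

  eraseCtx-wshift : ∀ Γ → eraseCtx (map wshiftJ Γ) ≡ eraseCtx Γ
  eraseCtx-wshift []      = refl
  eraseCtx-wshift (J ∷ Γ) = cong₂ _∷_ (eraseJ-wshift J) (eraseCtx-wshift Γ)

  erase-split : ∀ {Δ} Θ Δ₁ Δ₂ → Δ ↭ Θ ++ Δ₁ ++ Δ₂ →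
                eraseCtx Δ ↭ eraseCtx Θ ++ eraseCtx Δ₁ ++ eraseCtx Δ₂
  erase-split Θ Δ₁ Δ₂ p =
    ↭-trans (map⁺ eraseJ p)
      (↭-reflexive (trans (map-++ eraseJ Θ (Δ₁ ++ Δ₂))
                          (cong (eraseCtx Θ ++_) (map-++ eraseJ Δ₁ Δ₂))))

  -- Soundness of erasure: every HyLL derivation erases to an ILL derivation.
  -- Hybrid right rules vanish; hybrid left rules become an exchange.
  erase-sound : ∀ {Γ Δ C} → Γ ⨾ Δ ⟹ C → eraseCtx Γ ⨾ eraseCtx Δ ⟹ᴵ eraseJ C
  erase-sound init          = ILL.init
  erase-sound (copy m d)    = ILL.copy (∈-map⁺ eraseJ m) (erase-sound d)
  erase-sound (⊗R {Δ₁ = Δ₁} {Δ₂} p d e) =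
    ILL.⊗R (erase-split [] Δ₁ Δ₂ p) (erase-sound d) (erase-sound e)
  erase-sound (⊗L p d)      = ILL.⊗L (map⁺ eraseJ p) (erase-sound d)
  erase-sound 𝟏R            = ILL.𝟏R
  erase-sound (𝟏L p d)      = ILL.𝟏L (map⁺ eraseJ p) (erase-sound d)
  erase-sound (⊸R d)        = ILL.⊸R (erase-sound d)
  erase-sound (⊸L {Δ₁ = Δ₁} {Δ₂} p d e) =
    ILL.⊸L (erase-split (_ ∷ []) Δ₁ Δ₂ p) (erase-sound d) (erase-sound e)
  erase-sound ⊤R            = ILL.⊤R
  erase-sound (&R d e)      = ILL.&R (erase-sound d) (erase-sound e)
  erase-sound (&L₁ p d)     = ILL.&L₁ (map⁺ eraseJ p) (erase-sound d)
  erase-sound (&L₂ p d)     = ILL.&L₂ (map⁺ eraseJ p) (erase-sound d)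
  erase-sound (⊕R₁ d)       = ILL.⊕R₁ (erase-sound d)
  erase-sound (⊕R₂ d)       = ILL.⊕R₂ (erase-sound d)
  erase-sound (⊕L p d e)    = ILL.⊕L (map⁺ eraseJ p) (erase-sound d) (erase-sound e)
  erase-sound (𝟎L p)        = ILL.𝟎L (map⁺ eraseJ p)
  erase-sound (∀tR {Γ} {Δ} d) =
    ILL.∀tR (cast (eraseCtx-tshift Γ) (eraseCtx-tshift Δ) refl (erase-sound d))
  erase-sound (∀tL {A = A} τ p d) =
    ILL.∀tL τ (map⁺ eraseJ p)
      (cast refl (cong (_∷ _) (erase-subP (singleT τ) A)) refl (erase-sound d))
  erase-sound (∃tR {A = A} τ d) =
    ILL.∃tR τ (cast refl refl (erase-subP (singleT τ) A) (erase-sound d))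
  erase-sound (∃tL {Γ} {Δ' = Δ'} {C = C} p d) =
    ILL.∃tL (map⁺ eraseJ p)
      (cast (eraseCtx-tshift Γ) (cong (_ ∷_) (eraseCtx-tshift Δ')) (eraseJ-tshift C)
            (erase-sound d))
  erase-sound (!R d)        = ILL.!R (erase-sound d)
  erase-sound (!L p d)      = ILL.!L (map⁺ eraseJ p) (erase-sound d)
  erase-sound (∀wR {Γ} {Δ} d) =
    cast (eraseCtx-wshift Γ) (eraseCtx-wshift Δ) refl (erase-sound d)
  erase-sound (∀wL {A = A} τ p d) =
    exchange (↭-sym (map⁺ eraseJ p))
      (cast refl (cong (_∷ _) (erase-wsubP (singleW τ) A)) refl (erase-sound d))
  erase-sound (∃wR {A = A} τ d) =
    cast refl refl (erase-wsubP (singleW τ) A) (erase-sound d)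
  erase-sound (∃wL {Γ} {Δ' = Δ'} {C = C} p d) =
    exchange (↭-sym (map⁺ eraseJ p))
      (cast (eraseCtx-wshift Γ) (cong (_ ∷_) (eraseCtx-wshift Δ')) (eraseJ-wshift C)
            (erase-sound d))
  erase-sound (atR d)       = erase-sound d
  erase-sound (atL p d)     = exchange (↭-sym (map⁺ eraseJ p)) (erase-sound d)
  erase-sound (↓R {A = A} {w} d) =
    cast refl refl (erase-wsubP (singleW w) A) (erase-sound d)
  erase-sound (↓L {A = A} {v} p d) =
    exchange (↭-sym (map⁺ eraseJ p))
      (cast refl (cong (_∷ _) (erase-wsubP (singleW v) A)) refl (erase-sound d))

  erase-embed : ∀ A → erase (embed A) ≡ A
  erase-embed (ILL.atom a ts) = refl
  erase-embed (A ILL.⊗ B)     = cong₂ ILL._⊗_ (erase-embed A) (erase-embed B)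
  erase-embed ILL.𝟏           = refl
  erase-embed (A ILL.⊸ B)     = cong₂ ILL._⊸_ (erase-embed A) (erase-embed B)
  erase-embed (A ILL.& B)     = cong₂ ILL._&_ (erase-embed A) (erase-embed B)
  erase-embed ILL.⊤ₚ          = refl
  erase-embed (A ILL.⊕ B)     = cong₂ ILL._⊕_ (erase-embed A) (erase-embed B)
  erase-embed ILL.𝟎           = refl
  erase-embed (ILL.! A)       = cong ILL.!_ (erase-embed A)
  erase-embed (ILL.∀t A)      = cong ILL.∀t (erase-embed A)
  erase-embed (ILL.∃t A)      = cong ILL.∃t (erase-embed A)

  erase-labelled : ∀ (w : Wd W) Γ → eraseCtx (Γ ＠ₗ w) ≡ Γ
  erase-labelled w []      = refl
  erase-labelled w (A ∷ Γ) = cong₂ _∷_ (erase-embed A) (erase-labelled w Γ)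

mainTheorem9 : ∀ {c ℓ} (M : Monoid c ℓ) (Γ Δ : List IProp) (C : IProp)
                 (w : Wd (Monoid.Carrier M)) →
                 (Γ ＠ₗ w) ⨾ (Δ ＠ₗ w) ⟹ (embed C ＠ w) →
                 Γ ⨾ Δ ⟹ᴵ C
mainTheorem9 M Γ Δ C w d =
  cast (erase-labelled w Γ) (erase-labelled w Δ) (erase-embed C) (erase-sound d)
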